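{- Let $S$ be a finite nonempty set and $p:2^S\to\mathbb{Z}\cup\{ -\infty\}$ an integer-valued supermodular function with $p(\emptyset)=0$ and $p(S)>-\infty$. For each integer $\beta$ let $L(\beta)$ denote the smallest maximizer of $p(X)-\beta|X|$ over $X\subseteq S$. Let $\beta_1>\dots>\beta_q$ be the essential values defined in the context. Then, as $\beta$ decreases, $L(\beta)$ is monotone nondecreasing (with respect to inclusion); $L(\beta)\ne L(\beta-1)$ holds if and only if $\beta$ is equal to an essential value; and consequently $$\emptyset=L(\beta_1)\subset L(\beta_1-1)=\dots=L(\beta_2)\subset L(\beta_2-1)=\dots=L(\beta_q)\subset L(\beta_q-1)=S.$$
   Context: Supermodular: $p(X)+p(Y)\le p(X\cap Y)+p(X\cup Y)$ whenever $p(X),p(Y)$ are finite. Essential values: set $C_0=\emptyset$ and for $j=1,2,\dots$ while $C_{j-1}\ne S$, with $\overline{C_{j-1}}=S\setminus C_{j-1}$, let $\beta_j=\max\{\lceil (p(X\cup C_{j-1})-p(C_{j-1}))/|X|\rceil : \emptyset\ne X\subseteq\overline{C_{j-1}}\}$, $h_j(X)=p(X\cup C_{j-1})-(\beta_j-1)|X|-p(C_{j-1})$ for $X\subseteq\overline{C_{j-1}}$, $S_j$ the smallest subset of $\overline{C_{j-1}}$ maximizing $h_j$, and $C_j=C_{j-1}\cup S_j$; $q$ is the index with $C_{q-1}\ne S$, $C_q=S$. The symbol $\subset$ denotes proper inclusion. -}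

module Defs where

open import Data.Nat using (ℕ; suc)
open import Data.Integer using (ℤ; _+_; _-_; _*_; _≤_; _<_; +_; 1ℤ)
open import Data.Maybe using (Maybe; just; nothing)
open import Data.Fin.Subset using (Subset; _∪_; _∩_; _⊆_; ∣_∣; ∁; Nonempty)
open import Data.Product using (Σ; _×_)
open import Relation.Binary.PropositionalEquality using (_≡_; _≢_)

-- An extended-integer valued set function: nothing represents -∞.
SetFn : ℕ → Set
SetFn n = Subset n → Maybe ℤ

-- Extended subtraction (x - y); -∞ whenever an argument is -∞
-- (only ever used with y finite).
_⊖_ : Maybe ℤ → Maybe ℤ → Maybe ℤ
just a ⊖ just b = just (a - b)
_ ⊖ _ = nothing

-- Supermodularity: p(X)+p(Y) ≤ p(X∩Y)+p(X∪Y) whenever p(X), p(Y) are finite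
-- (with -∞ on the right the inequality fails, so the right side must be finite).
Supermodular : ∀ {n} → SetFn n → Set
Supermodular p = ∀ X Y a b → p X ≡ just a → p Y ≡ just b →
  Σ ℤ λ c → Σ ℤ λ d → p (X ∩ Y) ≡ just c × p (X ∪ Y) ≡ just d × a + b ≤ c + d

IsMaximizer : ∀ {n} → (Subset n → Set) → SetFn n → Subset n → Set
IsMaximizer D f X = D X × Σ ℤ λ v → f X ≡ just v × (∀ Y w → D Y → f Y ≡ just w → w ≤ v)

IsSmallestMaximizer : ∀ {n} → (Subset n → Set) → SetFn n → Subset n → Set
IsSmallestMaximizer D f X = IsMaximizer D f X × (∀ Y → IsMaximizer D f Y → X ⊆ Y)


shifted : ∀ {n} → SetFn n → ℤ → SetFn n
shifted p β X = p X ⊖ just (β * + ∣ X ∣)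

IsCeilDiv : ℤ → ℤ → ℤ → Set
IsCeilDiv a k r = k * (r - 1ℤ) < a × a ≤ k * r

hFun : ∀ {n} → SetFn n → Subset n → ℤ → SetFn n
hFun p C β X = (p (X ∪ C) ⊖ just ((β - 1ℤ) * + ∣ X ∣)) ⊖ p C

RatioValue : ∀ {n} → SetFn n → Subset n → Subset n → ℤ → Set
RatioValue p C X r = Nonempty X × X ⊆ ∁ C ×
  Σ ℤ λ a → Σ ℤ λ c → p (X ∪ C) ≡ just a × p C ≡ just c × IsCeilDiv (a - c) (+ ∣ X ∣) r

SubsetOf : ∀ {n} → Subset n → Subset n → Set
SubsetOf D X = X ⊆ D

-- One step j ↦ j+1 of the essential-value procedure (C = C_j, b = β_{j+1},
-- Sj = S_{j+1}, C' = C_{j+1}).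
EssentialStep : ∀ {n} → SetFn n → Subset n → ℤ → Subset n → Subset n → Set
EssentialStep p C b Sj C' =
  ((Σ (Subset _) λ X → RatioValue p C X b) × (∀ X r → RatioValue p C X r → r ≤ b))
  × IsSmallestMaximizer (SubsetOf (∁ C)) (hFun p C b) Sj
  × C' ≡ C ∪ Sj

open import Data.Fin.Subset using (⊥; ⊤)
open import Data.Nat using () renaming (_<_ to _<ℕ_)
open import Data.Unit using () renaming (⊤ to Unit)

AnySubset : ∀ {n} → Subset n → Set
AnySubset _ = Unit

-- q, β_1..β_q (β j for 1 ≤ j ≤ q), C_0..C_q, S_1..S_q are the output of the
-- essential-value procedure of the context.
EssentialValues : ∀ {n} → SetFn n → ℕ → (ℕ → ℤ) → (ℕ → Subset n) → (ℕ → Subset n) → Set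
EssentialValues p q β C Sj =
  C 0 ≡ ⊥
  × C q ≡ ⊤
  × (∀ j → j <ℕ q → C j ≢ ⊤ × EssentialStep p (C j) (β (suc j)) (Sj (suc j)) (C (suc j)))

module Submission where

-- Then L(b) = C_j on the j-th interval
-- β_{j+1} ≤ b ≤ β_j - 1 of the essential values, and L grows as b decreases.
--
-- The argument is phrased with peaks: T is the peak of g among a family of sets
-- if g(T) is maximal there and every maximizer in the family contains T.  The
-- central fact, peak-glue, says that for supermodular g, if C is the peak among
-- its own subsets and T the peak among the supersets of C, then T is the global
-- peak, i.e. the smallest maximizer.  Applied to g = p - b|·| (again supermodular):
-- above C_j, the ratio bound β_{j+1} makes C_j the peak for b ≥ β_{j+1}, and the
-- choice of S_{j+1} makes C_{j+1} the peak at b = β_{j+1} - 1; below C_j, gluing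
-- these by induction on j makes C_j the peak among its subsets for b ≤ β_j - 1.
-- The clauses of the proposition then follow from L(b) = C_j, from the strict
-- growth of the chain C_j and the strict decrease of the β_j, and from a separate
-- general lemma (smallest-maximizer-antitone) for the monotonicity of L.

open import Defs
open import Data.Nat using (ℕ; suc) renaming (_≤_ to _≤ℕ_; _<_ to _<ℕ_)
open import Data.Integer using (ℤ; 0ℤ; 1ℤ; _-_; _≤_; _<_)
open import Data.Maybe using (just)
open import Data.Fin.Subset using (Subset; ⊥; ⊤; _⊆_; _⊂_)
open import Data.Product using (Σ; _×_)
open import Relation.Binary.PropositionalEquality using (_≡_; _≢_)

open import Data.Bool using (true; false)
open import Data.Nat as ℕ using (zero)
import Data.Nat.Properties as ℕP
open import Data.Integer as ℤ using (_+_; _*_; +_; -_)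
import Data.Integer.Properties as ℤP
open import Algebra.Bundles using (AbelianGroup)
open import Algebra.Properties.Group (AbelianGroup.group ℤP.+-0-abelianGroup) using (∙-cancelˡ)
open import Data.Integer.DivMod using (_/ℕ_; _%ℕ_; a≡a%ℕn+[a/ℕn]*n; n%ℕd<d)
open import Data.Integer.Tactic.RingSolver using (solve-∀)
open import Data.Fin.Subset using (_∪_; _∩_; ∁; Nonempty; ∣_∣)
open import Data.Fin.Subset.Properties
import Data.Fin as Fin
open import Data.Product using (_,_; proj₁; proj₂)
open import Data.Maybe.Properties using (just-injective)
open import Data.Sum using (_⊎_; inj₁; inj₂)
open import Data.Unit using (tt) renaming (⊤ to Unit)
open import Data.Empty using (⊥-elim)
open import Relation.Nullary using (¬_; yes; no)
open import Data.Maybe as Maybe using (nothing)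
open import Data.Maybe.Properties using (map-just)
open import Relation.Binary.PropositionalEquality using (refl; sym; trans; cong; subst; subst₂; module ≡-Reasoning)

module _ {n : ℕ} where

  ∪-least : {A B Z : Subset n} → A ⊆ Z → B ⊆ Z → A ∪ B ⊆ Z
  ∪-least {A} {B} A⊆Z B⊆Z x∈A∪B with x∈p∪q⁻ A B x∈A∪B
  ... | inj₁ x∈A = A⊆Z x∈A
  ... | inj₂ x∈B = B⊆Z x∈B

  split-superset : (X C : Subset n) → C ⊆ X → (X ∩ ∁ C) ∪ C ≡ X
  split-superset X C C⊆X = begin
    (X ∩ ∁ C) ∪ C        ≡⟨ ∪-distribʳ-∩ C X (∁ C) ⟩
    (X ∪ C) ∩ (∁ C ∪ C)  ≡⟨ cong ((X ∪ C) ∩_) (∪-inverseˡ C) ⟩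
    (X ∪ C) ∩ ⊤          ≡⟨ ∩-identityʳ (X ∪ C) ⟩
    X ∪ C                ≡⟨ ⊆-antisym (∪-least ⊆-refl C⊆X) (p⊆p∪q C) ⟩
    X                    ∎
    where open ≡-Reasoning

  disjoint-extension-⊂ : ∀ {C S : Subset n} → S ⊆ ∁ C → C ∪ S ≢ C → C ⊂ C ∪ S
  disjoint-extension-⊂ {C} {S} S⊆∁C C∪S≢C with nonempty? S
  ... | yes (x , x∈S) = p⊆p∪q S , x , q⊆p∪q C S x∈S , x∈∁p⇒x∉p (S⊆∁C x∈S)
  ... | no S-empty    = ⊥-elim (C∪S≢C (trans (cong (C ∪_) (Empty-unique S-empty)) (∪-identityʳ C)))

module _ where
  open import Data.Vec using ([]; _∷_)

  card-∪∩ : ∀ {n} (X Y : Subset n) → ∣ X ∪ Y ∣ ℕ.+ ∣ X ∩ Y ∣ ≡ ∣ X ∣ ℕ.+ ∣ Y ∣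
  card-∪∩ []          []          = refl
  card-∪∩ (true ∷ X)  (true ∷ Y)  = cong suc (begin
    ∣ X ∪ Y ∣ ℕ.+ suc ∣ X ∩ Y ∣  ≡⟨ ℕP.+-suc _ _ ⟩
    suc (∣ X ∪ Y ∣ ℕ.+ ∣ X ∩ Y ∣) ≡⟨ cong suc (card-∪∩ X Y) ⟩
    suc (∣ X ∣ ℕ.+ ∣ Y ∣)         ≡⟨ ℕP.+-suc _ _ ⟨
    ∣ X ∣ ℕ.+ suc ∣ Y ∣           ∎)
    where open ≡-Reasoning
  card-∪∩ (true ∷ X)  (false ∷ Y) = cong suc (card-∪∩ X Y)
  card-∪∩ (false ∷ X) (true ∷ Y)  = trans (cong suc (card-∪∩ X Y)) (sym (ℕP.+-suc ∣ X ∣ ∣ Y ∣))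
  card-∪∩ (false ∷ X) (false ∷ Y) = card-∪∩ X Y

  card-disjoint-∪ : ∀ {n} (X Y : Subset n) → X ⊆ ∁ Y → ∣ X ∪ Y ∣ ≡ ∣ X ∣ ℕ.+ ∣ Y ∣
  card-disjoint-∪ {n} X Y X⊆∁Y = begin
    ∣ X ∪ Y ∣                  ≡⟨ ℕP.+-identityʳ _ ⟨
    ∣ X ∪ Y ∣ ℕ.+ 0            ≡⟨ cong (λ k → ∣ X ∪ Y ∣ ℕ.+ k) (trans (sym (∣⊥∣≡0 n)) (cong ∣_∣ (sym X∩Y≡⊥))) ⟩
    ∣ X ∪ Y ∣ ℕ.+ ∣ X ∩ Y ∣    ≡⟨ card-∪∩ X Y ⟩
    ∣ X ∣ ℕ.+ ∣ Y ∣            ∎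
    where
    open ≡-Reasoning
    X∩Y≡⊥ : X ∩ Y ≡ ⊥
    X∩Y≡⊥ = Empty-unique λ (x , x∈X∩Y) →
      let (x∈X , x∈Y) = x∈p∩q⁻ X Y x∈X∩Y in x∈∁p⇒x∉p (X⊆∁Y x∈X) x∈Y

  card-extension : ∀ {n} {W C : Subset n} → W ⊆ ∁ C → + ∣ W ∪ C ∣ ≡ + ∣ W ∣ + + ∣ C ∣
  card-extension {W = W} {C} W⊆∁C = trans (cong +_ (card-disjoint-∪ W C W⊆∁C)) (ℤP.pos-+ ∣ W ∣ ∣ C ∣)

  nonempty⇒card-suc : ∀ {n} (X : Subset n) → Nonempty X → Σ ℕ λ m → ∣ X ∣ ≡ suc m
  nonempty⇒card-suc (true ∷ X)  _                  = ∣ X ∣ , refl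
  nonempty⇒card-suc (false ∷ X) (Fin.suc x , x∈X) = nonempty⇒card-suc X (x , drop-there x∈X)

+-sub : ∀ u v → (u + v) - v ≡ u
+-sub = solve-∀

-- ⌈a / k⌉ exists for every positive k: write -a = ρ + quot·k with 0 ≤ ρ < k
-- (floor division) and take r = -quot, so that k·r = a + ρ.
ceilDiv-exists : ∀ a m → Σ ℤ λ r → IsCeilDiv a (+ suc m) r
ceilDiv-exists a m = - quot , below , above
  where
  open ℤP.≤-Reasoning
  k quot ρ : ℤ
  k    = + suc m
  quot = (- a) /ℕ suc m
  ρ    = + ((- a) %ℕ suc m)
  k*r≡a+ρ : k * (- quot) ≡ a + ρ
  k*r≡a+ρ = begin-equality
    k * (- quot)                 ≡⟨ expand ρ quot k ⟩
    - (ρ + quot * k) + ρ         ≡⟨ cong (λ t → - t + ρ) (a≡a%ℕn+[a/ℕn]*n (- a) (suc m)) ⟨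
    - (- a) + ρ                  ≡⟨ cong (_+ ρ) (ℤP.neg-involutive a) ⟩
    a + ρ                        ∎
    where
    expand : ∀ ρ quot k → k * (- quot) ≡ - (ρ + quot * k) + ρ
    expand = solve-∀
  below : k * (- quot - 1ℤ) < a
  below = begin-strict
    k * (- quot - 1ℤ)  ≡⟨ distrib (- quot) k ⟩
    k * (- quot) - k   ≡⟨ cong (_- k) k*r≡a+ρ ⟩
    (a + ρ) - k        <⟨ ℤP.+-monoˡ-< (- k) (ℤP.+-monoʳ-< a (ℤ.+<+ (n%ℕd<d (- a) (suc m)))) ⟩
    (a + k) - k        ≡⟨ +-sub a k ⟩
    a                  ∎
    where
    distrib : ∀ x k → k * (x - 1ℤ) ≡ k * x - k
    distrib = solve-∀
  above : a ≤ k * (- quot)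
  above = begin
    a                  ≤⟨ ℤP.i≤i+j a ρ ⟩
    a + ρ              ≡⟨ k*r≡a+ρ ⟨
    k * (- quot)       ∎

<⇒≤-1 : ∀ {i j} → i < j → i ≤ j - 1ℤ
<⇒≤-1 {i} {j} i<j = subst (i ≤_) (ℤP.+-comm (- 1ℤ) j) (ℤP.i<j⇒i≤pred[j] i<j)

≤-+-nonneg : ∀ u {e} → 0ℤ ≤ e → u ≤ u + e
≤-+-nonneg u 0≤e = subst (_≤ u + _) (ℤP.+-identityʳ u) (ℤP.+-monoʳ-≤ u 0≤e)

cancel-≤ : ∀ {x y c d} → x + c ≤ y + d → d ≤ c → x ≤ y
cancel-≤ {x} {y} {c} {d} x+c≤y+d d≤c = begin
  x              ≡⟨ +-sub x c ⟨
  (x + c) - c    ≤⟨ ℤP.+-monoˡ-≤ (- c) (ℤP.≤-trans x+c≤y+d (ℤP.+-monoʳ-≤ y d≤c)) ⟩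
  (y + c) - c    ≡⟨ +-sub y c ⟩
  y              ∎
  where
  open ℤP.≤-Reasoning

gap-antitone : ∀ x z {b b′} {k m} → k ≤ℕ m → b ≤ b′ →
               (x - b′ * + m) - (z - b′ * + k) ≤ (x - b * + m) - (z - b * + k)
gap-antitone x z {b} {b′} {k} k≤m b≤b′ with ℕP.m≤n⇒∃[o]m+o≡n k≤m
... | d , refl = begin
  (x - b′ * + (k ℕ.+ d)) - (z - b′ * + k)                      ≡⟨ cong (λ t → (x - b′ * t) - (z - b′ * + k)) (ℤP.pos-+ k d) ⟩
  (x - b′ * (+ k + + d)) - (z - b′ * + k)                      ≤⟨ ≤-+-nonneg _ (ℤP.*-monoʳ-≤-nonNeg (+ d) (ℤP.i≤j⇒0≤j-i b≤b′)) ⟩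
  (x - b′ * (+ k + + d)) - (z - b′ * + k) + (b′ - b) * + d     ≡⟨ slope-change x z b b′ (+ k) (+ d) ⟩
  (x - b * (+ k + + d)) - (z - b * + k)                        ≡⟨ cong (λ t → (x - b * t) - (z - b * + k)) (ℤP.pos-+ k d) ⟨
  (x - b * + (k ℕ.+ d)) - (z - b * + k)                        ∎
  where
  open ℤP.≤-Reasoning
  slope-change : ∀ x z b b′ k d → (x - b′ * (k + d)) - (z - b′ * k) + (b′ - b) * d ≡ (x - b * (k + d)) - (z - b * k)
  slope-change = solve-∀

-- Adding k elements, with p-increase a - c, to a set of size m changes the
-- value p - b|·| from c - bm to a - b(k + m); these compare the two values.
private
  regroup-new : ∀ a c b k m → a - b * (k + m) ≡ (a - c) + (c - b * (k + m))
  regroup-new = solve-∀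
  regroup-old : ∀ c b k m → c - b * m ≡ k * b + (c - b * (k + m))
  regroup-old = solve-∀

shifted-increase-≤ : ∀ {a c} b k m → a - c ≤ k * b → a - b * (k + m) ≤ c - b * m
shifted-increase-≤ {a} {c} b k m a-c≤kb = begin
  a - b * (k + m)               ≡⟨ regroup-new a c b k m ⟩
  (a - c) + (c - b * (k + m))   ≤⟨ ℤP.+-monoˡ-≤ _ a-c≤kb ⟩
  k * b + (c - b * (k + m))     ≡⟨ regroup-old c b k m ⟨
  c - b * m                     ∎
  where open ℤP.≤-Reasoning

shifted-increase-< : ∀ {a c} b k m → k * b < a - c → c - b * m < a - b * (k + m)
shifted-increase-< {a} {c} b k m kb<a-c = begin-strict
  c - b * m                     ≡⟨ regroup-old c b k m ⟩
  k * b + (c - b * (k + m))     <⟨ ℤP.+-monoˡ-< _ kb<a-c ⟩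
  (a - c) + (c - b * (k + m))   ≡⟨ regroup-new a c b k m ⟨
  a - b * (k + m)               ∎
  where open ℤP.≤-Reasoning

<⇒0<-diff : ∀ {i j} → i < j → 0ℤ < j - i
<⇒0<-diff {i} {j} i<j = subst (_< j - i) (ℤP.+-inverseʳ i) (ℤP.+-monoˡ-< (- i) i<j)

0<-diff⇒< : ∀ {i j} → 0ℤ < j - i → i < j
0<-diff⇒< {i} {j} 0<j-i = subst₂ _<_ (ℤP.+-identityˡ i) (diff-add j i) (ℤP.+-monoˡ-< i 0<j-i)
  where
  diff-add : ∀ j i → (j - i) + i ≡ j
  diff-add = solve-∀

map-just-inv : ∀ {A B : Set} {f : A → B} m {y} → Maybe.map f m ≡ just y → Σ A λ u → m ≡ just u × y ≡ f u
map-just-inv (just u) refl = u , refl , refl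

⊖-just-right-inv : ∀ m m′ {v} → m ⊖ m′ ≡ just v → Σ ℤ λ c → m′ ≡ just c
⊖-just-right-inv (just a) (just c) refl = c , refl

⊖-just-inv : ∀ m {k v} → m ⊖ just k ≡ just v → Σ ℤ λ a → m ≡ just a × v ≡ a - k
⊖-just-inv (just a) refl = a , refl , refl

SupersetOf : ∀ {n} → Subset n → Subset n → Set
SupersetOf C X = C ⊆ X

Peak : ∀ {n} → (Subset n → Set) → SetFn n → Subset n → Set
Peak D g T = Σ ℤ λ t → g T ≡ just t × (∀ Z z → D Z → g Z ≡ just z → z ≤ t × (z ≡ t → T ⊆ Z))

Exceeds : ∀ {n} → SetFn n → Subset n → Subset n → Set
Exceeds g X Y = Σ ℤ λ x → Σ ℤ λ y → g X ≡ just x × g Y ≡ just y × y < x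

module _ {n : ℕ} {g : SetFn n} where

  peak-of-only-candidate : ∀ {D T t} → (∀ Z → D Z → Z ≡ T) → g T ≡ just t → Peak D g T
  peak-of-only-candidate only gT = _ , gT , λ Z z DZ gZ →
    ℤP.≤-reflexive (just-injective (trans (sym gZ) (trans (cong g (only Z DZ)) gT))) ,
    λ _ → ⊆-reflexive (sym (only Z DZ))

  peak-restrict : ∀ {D T} → Peak AnySubset g T → Peak D g T
  peak-restrict (t , gT , top) = t , gT , λ Z z _ → top Z z tt

  peak-not-exceeded : ∀ {D T X} → Peak D g T → D X → ¬ Exceeds g X T
  peak-not-exceeded (t , gT , top) DX (x , _ , gX , gT′ , y<x) =
    ℤP.<⇒≱ (subst (_< x) (just-injective (trans (sym gT′) gT)) y<x) (proj₁ (top _ x DX gX))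

  -- For any Z, g(Z) + g(C) ≤ g(Z ∩ C) + g(Z ∪ C) and each summand on the right
  -- is bounded by the corresponding peak.
  peak-glue : Supermodular g → ∀ {C T} → Peak (SubsetOf C) g C → Peak (SupersetOf C) g T → Peak AnySubset g T
  peak-glue sm {C} {T} (c , gC , below) (t , gT , above) = t , gT , λ Z z _ gZ → bound Z z gZ (sm Z C z c gZ gC)
    where
    bound : ∀ Z z → g Z ≡ just z →
            (Σ ℤ λ y → Σ ℤ λ d → g (Z ∩ C) ≡ just y × g (Z ∪ C) ≡ just d × z + c ≤ y + d) →
            z ≤ t × (z ≡ t → T ⊆ Z)
    bound Z z gZ (y , d , g∩ , g∪ , z+c≤y+d) = ℤP.≤-trans z≤d d≤t , attained
      where
      inside : y ≤ c × (y ≡ c → C ⊆ Z ∩ C)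
      inside = below (Z ∩ C) y (p∩q⊆q Z C) g∩
      outside : d ≤ t × (d ≡ t → T ⊆ Z ∪ C)
      outside = above (Z ∪ C) d (q⊆p∪q Z C) g∪
      d≤t : d ≤ t
      d≤t = proj₁ outside
      z≤d : z ≤ d
      z≤d = cancel-≤ (subst (z + c ≤_) (ℤP.+-comm y d) z+c≤y+d) (proj₁ inside)
      attained : z ≡ t → T ⊆ Z
      attained refl = ⊆-trans (proj₂ outside (ℤP.≤-antisym d≤t z≤d)) (∪-least ⊆-refl C⊆Z)
        where
        c≤y : c ≤ y
        c≤y = cancel-≤ (subst (_≤ y + d) (ℤP.+-comm z c) z+c≤y+d) d≤t
        C⊆Z : C ⊆ Z
        C⊆Z = ⊆-trans (proj₂ inside (ℤP.≤-antisym (proj₁ inside) c≤y)) (p∩q⊆p Z C)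

  peak-is-smallest-maximizer : ∀ {T L} → Peak AnySubset g T → IsSmallestMaximizer AnySubset g L → L ≡ T
  peak-is-smallest-maximizer {T} {L} (t , gT , top) ((_ , v , gL , L-max) , L-least) =
    ⊆-antisym (L-least T T-max) (proj₂ (top L v tt gL) v≡t)
    where
    T-max : IsMaximizer AnySubset g T
    T-max = tt , t , gT , λ Y y _ gY → proj₁ (top Y y tt gY)
    v≡t : v ≡ t
    v≡t = ℤP.≤-antisym (proj₁ (top L v tt gL)) (L-max T t tt gT)

module _ {n : ℕ} (p : SetFn n) where

  shifted-just : ∀ b {X a} → p X ≡ just a → shifted p b X ≡ just (a - b * + ∣ X ∣)
  shifted-just b pX rewrite pX = refl

  shifted-inv : ∀ b {X v} → shifted p b X ≡ just v → Σ ℤ λ a → p X ≡ just a × v ≡ a - b * + ∣ X ∣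
  shifted-inv b {X} gX = ⊖-just-inv (p X) gX

  -- Subtracting b|·| preserves supermodularity, as |X| + |Y| = |X ∩ Y| + |X ∪ Y|.
  shifted-supermodular : Supermodular p → ∀ b → Supermodular (shifted p b)
  shifted-supermodular sm b X Y _ _ gX gY with shifted-inv b gX | shifted-inv b gY
  ... | a , pX , refl | c , pY , refl with sm X Y a c pX pY
  ... | e , f , p∩ , p∪ , a+c≤e+f =
    e - b * + ∣ X ∩ Y ∣ , f - b * + ∣ X ∪ Y ∣ , shifted-just b p∩ , shifted-just b p∪ , (begin
      (a - b * + ∣ X ∣) + (c - b * + ∣ Y ∣)              ≡⟨ collect a c b _ _ ⟩
      (a + c) - b * (+ ∣ X ∣ + + ∣ Y ∣)                  ≤⟨ ℤP.+-monoˡ-≤ _ a+c≤e+f ⟩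
      (e + f) - b * (+ ∣ X ∣ + + ∣ Y ∣)                  ≡⟨ cong (λ t → (e + f) - b * t) cards ⟩
      (e + f) - b * (+ ∣ X ∩ Y ∣ + + ∣ X ∪ Y ∣)          ≡⟨ collect e f b _ _ ⟨
      (e - b * + ∣ X ∩ Y ∣) + (f - b * + ∣ X ∪ Y ∣)      ∎)
    where
    open ℤP.≤-Reasoning
    collect : ∀ a c b x y → (a - b * x) + (c - b * y) ≡ (a + c) - b * (x + y)
    collect = solve-∀
    cards : + ∣ X ∣ + + ∣ Y ∣ ≡ + ∣ X ∩ Y ∣ + + ∣ X ∪ Y ∣
    cards = begin-equality
      + ∣ X ∣ + + ∣ Y ∣                ≡⟨ ℤP.pos-+ ∣ X ∣ ∣ Y ∣ ⟨
      + (∣ X ∣ ℕ.+ ∣ Y ∣)              ≡⟨ cong +_ (trans (sym (card-∪∩ X Y)) (ℕP.+-comm ∣ X ∪ Y ∣ ∣ X ∩ Y ∣)) ⟩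
      + (∣ X ∩ Y ∣ ℕ.+ ∣ X ∪ Y ∣)      ≡⟨ ℤP.pos-+ ∣ X ∩ Y ∣ ∣ X ∪ Y ∣ ⟩
      + ∣ X ∩ Y ∣ + + ∣ X ∪ Y ∣        ∎

  exceeds-antitone : ∀ {X Y b b′} → Y ⊆ X → b ≤ b′ → Exceeds (shifted p b′) X Y → Exceeds (shifted p b) X Y
  exceeds-antitone {X} {Y} {b} {b′} Y⊆X b≤b′ (_ , _ , gX , gY , y<x)
    with shifted-inv b′ gX | shifted-inv b′ gY
  ... | a , pX , refl | c , pY , refl =
    a - b * + ∣ X ∣ , c - b * + ∣ Y ∣ , shifted-just b pX , shifted-just b pY ,
    0<-diff⇒< (ℤP.<-≤-trans (<⇒0<-diff y<x) (gap-antitone a c (p⊆q⇒∣p∣≤∣q∣ Y⊆X) b≤b′))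

  peak-below-antitone : ∀ {C b b′} → b ≤ b′ → Peak (SubsetOf C) (shifted p b′) C → Peak (SubsetOf C) (shifted p b) C
  peak-below-antitone {C} {b} {b′} b≤b′ (_ , gC , below) with shifted-inv b′ gC
  ... | c , pC , refl = c - b * + ∣ C ∣ , shifted-just b pC , compare
    where
    compare : ∀ Z z → Z ⊆ C → shifted p b Z ≡ just z → z ≤ c - b * + ∣ C ∣ × (z ≡ c - b * + ∣ C ∣ → C ⊆ Z)
    compare Z _ Z⊆C gZ with shifted-inv b gZ
    ... | a , pZ , refl = ℤP.0≤i-j⇒j≤i (ℤP.≤-trans (ℤP.i≤j⇒0≤j-i z′≤c′) gap) , attained
      where
      at-b′ : a - b′ * + ∣ Z ∣ ≤ c - b′ * + ∣ C ∣ × (a - b′ * + ∣ Z ∣ ≡ c - b′ * + ∣ C ∣ → C ⊆ Z)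
      at-b′ = below Z (a - b′ * + ∣ Z ∣) Z⊆C (shifted-just b′ pZ)
      z′≤c′ : a - b′ * + ∣ Z ∣ ≤ c - b′ * + ∣ C ∣
      z′≤c′ = proj₁ at-b′
      gap : (c - b′ * + ∣ C ∣) - (a - b′ * + ∣ Z ∣) ≤ (c - b * + ∣ C ∣) - (a - b * + ∣ Z ∣)
      gap = gap-antitone c a (p⊆q⇒∣p∣≤∣q∣ Z⊆C) b≤b′
      attained : a - b * + ∣ Z ∣ ≡ c - b * + ∣ C ∣ → C ⊆ Z
      attained z≡c = proj₂ at-b′ (ℤP.≤-antisym z′≤c′ (ℤP.i-j≤0⇒i≤j (ℤP.≤-trans gap (ℤP.≤-reflexive no-gap))))
        where
        no-gap : (c - b * + ∣ C ∣) - (a - b * + ∣ Z ∣) ≡ 0ℤ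
        no-gap = trans (cong (λ t → (c - b * + ∣ C ∣) - t) z≡c) (ℤP.+-inverseʳ (c - b * + ∣ C ∣))

  -- For supermodular p the smallest maximizer of p - b|·| grows as b decreases:
  -- with A, B the smallest maximizers at slopes b ≥ b′, supermodularity and the
  -- maximality of B show that A ∩ B is also a maximizer at slope b, so A ⊆ A ∩ B.
  smallest-maximizer-antitone : Supermodular p → ∀ {A B b b′} → b′ ≤ b →
    IsSmallestMaximizer AnySubset (shifted p b) A → IsSmallestMaximizer AnySubset (shifted p b′) B → A ⊆ B
  smallest-maximizer-antitone sm {A} {B} {b} {b′} b′≤b ((_ , α , gA , A-max) , A-least) ((_ , _ , gB′ , B-max) , _)
    with shifted-inv b′ gB′
  ... | β , pB , refl with shifted-supermodular sm b A B α _ gA (shifted-just b pB)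
  ... | ι , _ , g∩ , g∪ , α+gB≤ι+υ with shifted-inv b g∪
  ... | φ , p∪ , refl = ⊆-trans (A-least (A ∩ B) A∩B-max) (p∩q⊆q A B)
    where
    -- adding A to B does not pay at slope b′, hence not at the larger slope b
    union-no-gain : φ - b * + ∣ A ∪ B ∣ ≤ β - b * + ∣ B ∣
    union-no-gain = ℤP.i-j≤0⇒i≤j (ℤP.≤-trans
      (gap-antitone φ β (∣q∣≤∣p∪q∣ A B) b′≤b)
      (ℤP.i≤j⇒i-j≤0 (B-max (A ∪ B) _ tt (shifted-just b′ p∪))))
    α≤ι : α ≤ ι
    α≤ι = cancel-≤ α+gB≤ι+υ union-no-gain
    A∩B-max : IsMaximizer AnySubset (shifted p b) (A ∩ B)
    A∩B-max = tt , ι , g∩ , λ Y y _ gY → ℤP.≤-trans (A-max Y y tt gY) α≤ι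

  shifted-extension : ∀ b {C W a} → W ⊆ ∁ C → p (W ∪ C) ≡ just a →
                      shifted p b (W ∪ C) ≡ just (a - b * (+ ∣ W ∣ + + ∣ C ∣))
  shifted-extension b {a = a} W⊆∁C pWC =
    trans (shifted-just b pWC) (cong (λ k → just (a - b * k)) (card-extension W⊆∁C))

  ratio-exceeds : ∀ {C X B} → RatioValue p C X B → Exceeds (shifted p (B - 1ℤ)) (X ∪ C) C
  ratio-exceeds {C} {X} {B} (_ , X⊆∁C , a , c , pXC , pC , below-ceiling , _) =
    _ , _ , shifted-extension (B - 1ℤ) X⊆∁C pXC , shifted-just (B - 1ℤ) pC ,
    shifted-increase-< {a} {c} (B - 1ℤ) (+ ∣ X ∣) (+ ∣ C ∣) below-ceiling

  -- If every ratio over C is at most B, then for every slope b ≥ B no superset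
  -- of C beats C: adding W = X ∖ C raises p by at most |W|·⌈ratio⌉ ≤ |W|·b.
  ratio-bound-peak : ∀ {C c B b} → p C ≡ just c → (∀ X r → RatioValue p C X r → r ≤ B) → B ≤ b →
                     Peak (SupersetOf C) (shifted p b) C
  ratio-bound-peak {C} {c} {B} {b} pC ratio≤B B≤b = c - b * + ∣ C ∣ , shifted-just b pC ,
    λ X x C⊆X gX → no-gain X x C⊆X gX , λ _ → C⊆X
    where
    no-gain : ∀ X x → C ⊆ X → shifted p b X ≡ just x → x ≤ c - b * + ∣ C ∣
    no-gain X _ C⊆X gX with shifted-inv b gX | nonempty? (X ∩ ∁ C)
    ... | a , pX , refl | no W-empty = ℤP.≤-reflexive (just-injective (begin
          just (a - b * + ∣ X ∣)  ≡⟨ shifted-just b pX ⟨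
          shifted p b X          ≡⟨ cong (shifted p b) X≡C ⟩
          shifted p b C          ≡⟨ shifted-just b pC ⟩
          just (c - b * + ∣ C ∣)  ∎))
      where
      open ≡-Reasoning
      X≡C : X ≡ C
      X≡C = trans (sym (split-superset X C C⊆X)) (trans (cong (_∪ C) (Empty-unique W-empty)) (∪-identityˡ C))
    ... | a , pX , refl | yes W-nonempty = begin
          a - b * + ∣ X ∣                 ≡⟨ cong (λ k → a - b * k) card-X ⟩
          a - b * (+ ∣ W ∣ + + ∣ C ∣)     ≤⟨ shifted-increase-≤ {a} {c} b (+ ∣ W ∣) (+ ∣ C ∣) gain≤ ⟩
          c - b * + ∣ C ∣                 ∎
      where
      open ℤP.≤-Reasoning
      W : Subset n
      W = X ∩ ∁ C
      W⊆∁C : W ⊆ ∁ C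
      W⊆∁C = p∩q⊆q X (∁ C)
      pWC : p (W ∪ C) ≡ just a
      pWC = trans (cong p (split-superset X C C⊆X)) pX
      card-X : + ∣ X ∣ ≡ + ∣ W ∣ + + ∣ C ∣
      card-X = trans (cong (λ Y → + ∣ Y ∣) (sym (split-superset X C C⊆X))) (card-extension W⊆∁C)
      m : ℕ
      m = proj₁ (nonempty⇒card-suc W W-nonempty)
      card-W : ∣ W ∣ ≡ suc m
      card-W = proj₂ (nonempty⇒card-suc W W-nonempty)
      r : ℤ
      r = proj₁ (ceilDiv-exists (a - c) m)
      r-ceiling : IsCeilDiv (a - c) (+ ∣ W ∣) r
      r-ceiling = subst (λ k → IsCeilDiv (a - c) (+ k) r) (sym card-W) (proj₂ (ceilDiv-exists (a - c) m))
      r≤b : r ≤ b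
      r≤b = ℤP.≤-trans (ratio≤B W r (W-nonempty , W⊆∁C , a , c , pWC , pC , r-ceiling)) B≤b
      gain≤ : a - c ≤ + ∣ W ∣ * b
      gain≤ = ℤP.≤-trans (proj₂ r-ceiling) (ℤP.*-monoˡ-≤-nonNeg (+ ∣ W ∣) r≤b)

  hFun-gain : ∀ B {C c W} → p C ≡ just c → W ⊆ ∁ C →
    shifted p (B - 1ℤ) (W ∪ C) ≡ Maybe.map (_+_ (c - (B - 1ℤ) * + ∣ C ∣)) (hFun p C B W)
  hFun-gain B {C} {c} {W} pC W⊆∁C rewrite pC with p (W ∪ C)
  ... | nothing = refl
  ... | just a  = cong just (trans (cong (λ k → a - (B - 1ℤ) * k) (card-extension W⊆∁C)) (regroup a c (B - 1ℤ) _ _))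
    where
    regroup : ∀ a c b w m → a - b * (w + m) ≡ (c - b * m) + ((a - b * w) - c)
    regroup = solve-∀

  hFun-maximizer-peak : ∀ B {C c S} → p C ≡ just c → IsSmallestMaximizer (SubsetOf (∁ C)) (hFun p C B) S →
                        Peak (SupersetOf C) (shifted p (B - 1ℤ)) (S ∪ C)
  hFun-maximizer-peak B {C} {c} {S} pC ((S⊆∁C , v , hS , S-max) , S-least) =
    s + v , trans (hFun-gain B pC S⊆∁C) (map-just hS) , compare
    where
    s : ℤ
    s = c - (B - 1ℤ) * + ∣ C ∣
    compare : ∀ X x → C ⊆ X → shifted p (B - 1ℤ) X ≡ just x → x ≤ s + v × (x ≡ s + v → S ∪ C ⊆ X)
    compare X x C⊆X gX = from-gain (map-just-inv (hFun p C B W) gain)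
      where
      W : Subset n
      W = X ∩ ∁ C
      W⊆∁C : W ⊆ ∁ C
      W⊆∁C = p∩q⊆q X (∁ C)
      gain : Maybe.map (_+_ s) (hFun p C B W) ≡ just x
      gain = trans (sym (hFun-gain B pC W⊆∁C)) (trans (cong (shifted p (B - 1ℤ)) (split-superset X C C⊆X)) gX)
      from-gain : (Σ ℤ λ u → hFun p C B W ≡ just u × x ≡ s + u) → x ≤ s + v × (x ≡ s + v → S ∪ C ⊆ X)
      from-gain (u , hW , refl) = ℤP.+-monoʳ-≤ s u≤v ,
        λ s+u≡s+v → ∪-least (⊆-trans (S-least W (W-max (∙-cancelˡ s u v s+u≡s+v))) (p∩q⊆p X (∁ C))) C⊆X
        where
        u≤v : u ≤ v
        u≤v = S-max W u W⊆∁C hW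
        W-max : u ≡ v → IsMaximizer (SubsetOf (∁ C)) (hFun p C B) W
        W-max refl = W⊆∁C , u , hW , S-max

module EssentialChain {n : ℕ} {p : SetFn n} (sm : Supermodular p) (p⊤ : Σ ℤ λ c → p ⊤ ≡ just c)
                      {q : ℕ} {β : ℕ → ℤ} {C Sj : ℕ → Subset n} (ev : EssentialValues p q β C Sj) where

  C₀≡⊥ : C 0 ≡ ⊥
  C₀≡⊥ = proj₁ ev

  C_q≡⊤ : C q ≡ ⊤
  C_q≡⊤ = proj₁ (proj₂ ev)

  module _ {j : ℕ} (j<q : j <ℕ q) where

    private
      step : EssentialStep p (C j) (β (suc j)) (Sj (suc j)) (C (suc j))
      step = proj₂ (proj₂ (proj₂ ev) j j<q)
      S-max : IsSmallestMaximizer (SubsetOf (∁ (C j))) (hFun p (C j) (β (suc j))) (Sj (suc j))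
      S-max = proj₁ (proj₂ step)

    -- p is finite at C_j, as h_{j+1} is finite at its maximizer S_{j+1}.
    C-finite : Σ ℤ λ c → p (C j) ≡ just c
    C-finite = ⊖-just-right-inv _ (p (C j)) (proj₁ (proj₂ (proj₂ (proj₁ S-max))))

    step-peak : Peak (SupersetOf (C j)) (shifted p (β (suc j) - 1ℤ)) (C (suc j))
    step-peak = subst (Peak _ _) (trans (∪-comm (Sj (suc j)) (C j)) (sym (proj₂ (proj₂ step))))
                      (hFun-maximizer-peak p (β (suc j)) (proj₂ C-finite) S-max)

    -- Some superset of C_j beats C_j at slope β_{j+1} - 1 (the ratio β_{j+1} is attained).
    step-exceeded : Σ (Subset n) λ X → C j ⊆ X × Exceeds (shifted p (β (suc j) - 1ℤ)) X (C j)
    step-exceeded = let (X , ratio) = proj₁ (proj₁ step) in X ∪ C j , q⊆p∪q X (C j) , ratio-exceeds p ratio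

    -- No superset of C_j beats C_j at any slope b ≥ β_{j+1} (β_{j+1} bounds all ratios).
    step-no-gain : ∀ b → β (suc j) ≤ b → Peak (SupersetOf (C j)) (shifted p b) (C j)
    step-no-gain b = ratio-bound-peak p (proj₂ C-finite) (proj₂ (proj₁ step))

    chain-strict : C j ⊂ C (suc j)
    chain-strict = subst (C j ⊂_) (sym C′≡C∪S) (disjoint-extension-⊂ (proj₁ (proj₁ S-max)) grows)
      where
      C′≡C∪S : C (suc j) ≡ C j ∪ Sj (suc j)
      C′≡C∪S = proj₂ (proj₂ step)
      -- if S_{j+1} added nothing, the set beating C_j would beat the peak C_{j+1}
      grows : C j ∪ Sj (suc j) ≢ C j
      grows C∪S≡C with step-exceeded
      ... | X , C⊆X , X-beats-C = peak-not-exceeded step-peak C⊆X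
              (subst (Exceeds _ X) (sym (trans C′≡C∪S C∪S≡C)) X-beats-C)

  -- The essential values strictly decrease: if β_{i+2} ≥ β_{i+1}, the superset of
  -- C_{i+1} beating it at slope β_{i+2} - 1 would beat it at slope β_{i+1} - 1 as
  -- well, although C_{i+1} is the peak over the supersets of C_i at that slope.
  β-decreasing : ∀ i → suc i <ℕ q → β (suc (suc i)) < β (suc i)
  β-decreasing i i+1<q with β (suc (suc i)) ℤP.<? β (suc i) | step-exceeded i+1<q
  ... | yes decreasing    | _ = decreasing
  ... | no not-decreasing | X , C⊆X , X-beats = ⊥-elim (peak-not-exceeded (step-peak i<q)
        (⊆-trans (proj₁ (chain-strict i<q)) C⊆X)
        (exceeds-antitone p C⊆X (ℤP.+-monoˡ-≤ (- 1ℤ) (ℤP.≮⇒≥ not-decreasing)) X-beats))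
    where
    i<q : i <ℕ q
    i<q = ℕP.<-trans (ℕP.n<1+n i) i+1<q

  chain-finite : ∀ j → j ≤ℕ q → Σ ℤ λ c → p (C j) ≡ just c
  chain-finite j j≤q with ℕP.m≤n⇒m<n∨m≡n j≤q
  ... | inj₁ j<q  = C-finite j<q
  ... | inj₂ refl = proj₁ p⊤ , trans (cong p C_q≡⊤) (proj₂ p⊤)

  -- The j-th interval is β_{j+1} ≤ b ≤ β_j - 1, with no upper bound for j = 0
  -- and no lower bound for j = q.
  BelowTop : ℕ → ℤ → Set
  BelowTop zero    _ = Unit
  BelowTop (suc j) b = b ≤ β (suc j) - 1ℤ

  AboveBottom : ℕ → ℤ → Set
  AboveBottom j b = j ≡ q ⊎ (j <ℕ q × β (suc j) ≤ b)

  BelowTop-antitone : ∀ j {b b′} → b′ ≤ b → BelowTop j b → BelowTop j b′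
  BelowTop-antitone zero    _    _   = tt
  BelowTop-antitone (suc j) b′≤b b≤ = ℤP.≤-trans b′≤b b≤

  essential-below-top : ∀ j → j <ℕ q → BelowTop j (β (suc j))
  essential-below-top zero    _     = tt
  essential-below-top (suc i) i+1<q = <⇒≤-1 (β-decreasing i i+1<q)

  -- C_j is the peak of p - b|·| over its subsets for every b ≤ β_j - 1: glue the
  -- peak of C_j over its subsets (induction) to the step peak C_{j+1} over the
  -- supersets of C_j at slope β_{j+1} - 1, then lower the slope.
  peak-below : ∀ j → j ≤ℕ q → ∀ b → BelowTop j b → Peak (SubsetOf (C j)) (shifted p b) (C j)
  peak-below zero _ b _ = peak-of-only-candidate {D = SubsetOf (C 0)}
    (λ Z Z⊆C₀ → ⊆-antisym Z⊆C₀ (subst (_⊆ Z) (sym C₀≡⊥) ⊥⊆)) (shifted-just p b (proj₂ (chain-finite 0 ℕ.z≤n)))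
  peak-below (suc i) i<q b b≤ = peak-below-antitone p b≤ (peak-restrict (peak-glue (shifted-supermodular p sm B′)
    (peak-below i (ℕP.<⇒≤ i<q) B′ (BelowTop-antitone i (ℤP.i-j≤i (β (suc i)) 1ℤ) (essential-below-top i i<q)))
    (step-peak i<q)))
    where
    B′ : ℤ
    B′ = β (suc i) - 1ℤ

  peak-above : ∀ j {b} → AboveBottom j b → Peak (SupersetOf (C j)) (shifted p b) (C j)
  peak-above j {b} (inj₁ refl) = peak-of-only-candidate {D = SupersetOf (C q)}
    (λ Z C⊆Z → ⊆-antisym (subst (Z ⊆_) (sym C_q≡⊤) ⊆⊤) C⊆Z) (shifted-just p b (proj₂ (chain-finite q ℕP.≤-refl)))
  peak-above j (inj₂ (j<q , β≤b)) = step-no-gain j<q _ β≤b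

  peak-on-interval : ∀ {j b} → j ≤ℕ q → BelowTop j b → AboveBottom j b → Peak AnySubset (shifted p b) (C j)
  peak-on-interval {j} {b} j≤q top bottom =
    peak-glue (shifted-supermodular p sm b) (peak-below j j≤q b top) (peak-above j bottom)

  locate : ∀ b → Σ ℕ λ j → j ≤ℕ q × BelowTop j b × AboveBottom j b
  locate b = scan q 0 refl tt
    where
    scan : ∀ m j → j ℕ.+ m ≡ q → BelowTop j b → Σ ℕ λ j → j ≤ℕ q × BelowTop j b × AboveBottom j b
    scan zero j j+0≡q top = j , ℕP.≤-reflexive j≡q , top , inj₁ j≡q
      where
      j≡q : j ≡ q
      j≡q = trans (sym (ℕP.+-identityʳ j)) j+0≡q
    scan (suc m) j j+m+1≡q top with β (suc j) ℤP.≤? b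
    ... | yes β≤b = j , ℕP.<⇒≤ j<q , top , inj₂ (j<q , β≤b)
      where
      j<q : j <ℕ q
      j<q = subst (j <ℕ_) j+m+1≡q (ℕP.m<m+n j (ℕ.s≤s ℕ.z≤n))
    ... | no β≰b  = scan m (suc j) (trans (sym (ℕP.+-suc j m)) j+m+1≡q) (<⇒≤-1 (ℤP.≰⇒> β≰b))

module Breakpoints {n : ℕ} {p : SetFn (suc n)} (sm : Supermodular p) (p⊤ : Σ ℤ λ c → p ⊤ ≡ just c)
                   {L : ℤ → Subset (suc n)} (L-min : ∀ b → IsSmallestMaximizer AnySubset (shifted p b) (L b))
                   {q : ℕ} {β : ℕ → ℤ} {C Sj : ℕ → Subset (suc n)} (ev : EssentialValues p q β C Sj) where

  open EssentialChain sm p⊤ {q} {β} {C} {Sj} ev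

  L-antitone : ∀ b b′ → b′ ≤ b → L b ⊆ L b′
  L-antitone b b′ b′≤b = smallest-maximizer-antitone p sm b′≤b (L-min b) (L-min b′)

  L-on-interval : ∀ {j b} → j ≤ℕ q → BelowTop j b → AboveBottom j b → L b ≡ C j
  L-on-interval {b = b} j≤q top bottom = peak-is-smallest-maximizer (peak-on-interval j≤q top bottom) (L-min b)

  L-at-essential : ∀ i → i <ℕ q → L (β (suc i)) ≡ C i × L (β (suc i) - 1ℤ) ≡ C (suc i)
  L-at-essential i i<q =
    L-on-interval (ℕP.<⇒≤ i<q) (essential-below-top i i<q) (inj₂ (i<q , ℤP.≤-refl)) ,
    L-on-interval i<q ℤP.≤-refl after
    where
    after : AboveBottom (suc i) (β (suc i) - 1ℤ)
    after with ℕP.m≤n⇒m<n∨m≡n i<q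
    ... | inj₁ i+1<q = inj₂ (i+1<q , essential-below-top (suc i) i+1<q)
    ... | inj₂ i+1≡q = inj₁ i+1≡q

  no-jump-inside : ∀ {j b} → j ≤ℕ q → BelowTop j b → AboveBottom j b → AboveBottom j (b - 1ℤ) → L b ≡ L (b - 1ℤ)
  no-jump-inside {j} {b} j≤q top bottom bottom′ = trans (L-on-interval j≤q top bottom)
    (sym (L-on-interval j≤q (BelowTop-antitone j (ℤP.i-j≤i b 1ℤ) top) bottom′))

  jump⇒essential : ∀ b → L b ≢ L (b - 1ℤ) → Σ ℕ λ j → 1 ≤ℕ j × j ≤ℕ q × b ≡ β j
  jump⇒essential b jumps with locate b
  ... | j , j≤q , top , inj₁ j≡q = ⊥-elim (jumps (no-jump-inside j≤q top (inj₁ j≡q) (inj₁ j≡q)))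
  ... | j , j≤q , top , inj₂ (j<q , β≤b) with β (suc j) ℤP.≟ b
  ...   | yes β≡b = suc j , ℕ.s≤s ℕ.z≤n , j<q , sym β≡b
  ...   | no β≢b  = ⊥-elim (jumps (no-jump-inside j≤q top (inj₂ (j<q , β≤b))
                                     (inj₂ (j<q , <⇒≤-1 (ℤP.≤∧≢⇒< β≤b β≢b)))))

  essential⇒jump : ∀ b → Σ ℕ (λ j → 1 ≤ℕ j × j ≤ℕ q × b ≡ β j) → L b ≢ L (b - 1ℤ)
  essential⇒jump _ (suc i , _ , i<q , refl) L-same =
    ⊂-irref (trans (sym (proj₁ jump)) (trans L-same (proj₂ jump))) (chain-strict i<q)
    where
    jump : L (β (suc i)) ≡ C i × L (β (suc i) - 1ℤ) ≡ C (suc i)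
    jump = L-at-essential i i<q

  essential-decreasing : ∀ j → 1 ≤ℕ j → j <ℕ q → β (suc j) < β j
  essential-decreasing (suc i) _ = β-decreasing i

  -- The chain runs from ⊥ to ⊤, so it has at least one step.
  chain-nonempty : q ≢ 0
  chain-nonempty q≡0 with trans (sym C₀≡⊥) (trans (cong C (sym q≡0)) C_q≡⊤)
  ... | ()

  L-first : L (β 1) ≡ ⊥
  L-first = trans (proj₁ (L-at-essential 0 (ℕP.n≢0⇒n>0 chain-nonempty))) C₀≡⊥

  L-strict : ∀ j → 1 ≤ℕ j → j ≤ℕ q → L (β j) ⊂ L (β j - 1ℤ)
  L-strict (suc i) _ i<q = subst₂ _⊂_ (sym (proj₁ jump)) (sym (proj₂ jump)) (chain-strict i<q)
    where
    jump : L (β (suc i)) ≡ C i × L (β (suc i) - 1ℤ) ≡ C (suc i)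
    jump = L-at-essential i i<q

  L-constant-between : ∀ j → 1 ≤ℕ j → j <ℕ q → ∀ b → β (suc j) ≤ b → b ≤ β j - 1ℤ → L b ≡ L (β (suc j))
  L-constant-between (suc i) _ i+1<q b β≤b b≤ = trans (L-on-interval (ℕP.<⇒≤ i+1<q) b≤ (inj₂ (i+1<q , β≤b)))
    (sym (proj₁ (L-at-essential (suc i) i+1<q)))

  L-last : L (β q - 1ℤ) ≡ ⊤
  L-last = last (ℕP.suc-pred q {{ℕ.≢-nonZero chain-nonempty}})
    where
    last : ∀ {i} → suc i ≡ q → L (β q - 1ℤ) ≡ ⊤
    last refl = trans (proj₂ (L-at-essential _ ℕP.≤-refl)) C_q≡⊤

proposition6p5 : (n : ℕ) (p : SetFn (suc n)) → Supermodular p → p ⊥ ≡ just 0ℤ → Σ ℤ (λ c → p ⊤ ≡ just c) →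
    (L : ℤ → Subset (suc n)) → (∀ b → IsSmallestMaximizer AnySubset (shifted p b) (L b)) →
    (q : ℕ) (β : ℕ → ℤ) (C Sj : ℕ → Subset (suc n)) → EssentialValues p q β C Sj →
    (∀ b b′ → b′ ≤ b → L b ⊆ L b′)
    × (∀ b → (L b ≢ L (b - 1ℤ) → Σ ℕ (λ j → 1 ≤ℕ j × j ≤ℕ q × b ≡ β j))
             × (Σ ℕ (λ j → 1 ≤ℕ j × j ≤ℕ q × b ≡ β j) → L b ≢ L (b - 1ℤ)))
    × (∀ j → 1 ≤ℕ j → j <ℕ q → β (suc j) < β j)
    × L (β 1) ≡ ⊥
    × (∀ j → 1 ≤ℕ j → j ≤ℕ q → L (β j) ⊂ L (β j - 1ℤ))
    × (∀ j → 1 ≤ℕ j → j <ℕ q → ∀ b → β (suc j) ≤ b → b ≤ β j - 1ℤ → L b ≡ L (β (suc j)))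
    × L (β q - 1ℤ) ≡ ⊤
proposition6p5 n p sm _ p⊤ L L-min q β C Sj ev =
  L-antitone , (λ b → jump⇒essential b , essential⇒jump b) , essential-decreasing ,
  L-first , L-strict , L-constant-between , L-last
  where
  open Breakpoints sm p⊤ {L} L-min {q} {β} {C} {Sj} ev
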